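{- Let $f(x) = 1 + h_1x + h_2x^2 + \cdots$ be the unique power series with all $h_n \in \{1,2,3\}$ ($n\ge1$) that is the cube of an element of $R$, and set $h_0 = 1$. Then the sequence $(h_n)_{n \ge 0}$ is not periodic: there is no integer $\pi \ge 1$ with $h_{n+\pi} = h_n$ for all $n \ge 0$.
   Context: $R := 1 + x\mathbb{Z}[[x]]$ is the set of formal power series with integer coefficients and constant term $1$. -}

module Defs where

open import Data.Nat using (ℕ; zero; suc; _∸_; _≥_)
open import Data.Integer using (ℤ; _+_; _*_; +_)
open import Data.Product using (Σ; _×_)
open import Data.Sum using (_⊎_)
open import Relation.Binary.PropositionalEquality using (_≡_)

PowerSeries : Set
PowerSeries = ℕ → ℤ

private
  convSum : PowerSeries → PowerSeries → ℕ → ℕ → ℤ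
  convSum a b n zero    = a 0 * b n
  convSum a b n (suc k) = convSum a b n k + a (suc k) * b (n ∸ suc k)

_·ₚ_ : PowerSeries → PowerSeries → PowerSeries
(a ·ₚ b) n = convSum a b n n

-- Membership in R = 1 + xℤ[[x]]
InR : PowerSeries → Set
InR g = g 0 ≡ + 1

IsCubeInR : PowerSeries → Set
IsCubeInR f = Σ PowerSeries (λ g → InR g × (∀ n → f n ≡ ((g ·ₚ g) ·ₚ g) n))

In123 : ℤ → Set
In123 z = (z ≡ + 1) ⊎ ((z ≡ + 2) ⊎ (z ≡ + 3))

Periodic : (ℕ → ℤ) → Set
Periodic h = Σ ℕ (λ π → (π ≥ 1) × (∀ n → h (n Data.Nat.+ π) ≡ h n))

{-# OPTIONS --safe #-}
-- Write f = g³. Modulo 3 cubing is additive and fixes integers, so f ≡ g(x³): f_n ≡ 0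
-- unless 3 ∣ n, and f_{3m} ≡ g_m. For a period π this gives f_π = f_0 = 1 ≢ 0, so π = 3q,
-- and then g_{q+m} ≡ g_m. Thus u = (1 − x^q) g is congruent mod 3 to a polynomial A of
-- degree < q, so u³ ≡ A³ (mod 9) vanishes mod 9 in degrees ≥ 3q. But u³ = (1 − x^q)³ f,
-- whose coefficient of degree 3q + m is, by 3q-periodicity, 3 (f_{q+m} − f_{2q+m}). Hence
-- f_{q+m} ≡ f_{2q+m} (mod 3), and since coefficients lie in {1, 2, 3} they are equal: q is
-- a smaller period, and infinite descent concludes.

module Submission where

open import Defs
open import Algebra.Bundles using (CommutativeRing)
import Algebra.Construct.Pointwise as Pointwise
open import Algebra.Solver.Ring.AlmostCommutativeRing
  using (fromCommutativeRing; _-Raw-AlmostCommutative⟶_; Induced-equivalence)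
open import Data.Integer as ℤ using (ℤ; +_; -[1+_]; 0ℤ; _+_; _-_; _*_; -_)
import Data.Integer.Properties as ℤ
open import Algebra.Properties.CommutativeSemigroup ℤ.+-commutativeSemigroup
  using () renaming (interchange to +-interchange)
open import Data.Integer.Divisibility.Signed
  using (_∣_; divides; quotient; _∣?_; ∣-refl; ∣m∣n⇒∣m+n; ∣m⇒∣-m; ∣n⇒∣m*n; *-cancelˡ-∣)
open import Data.Integer.Tactic.RingSolver using (solve-∀)
open import Data.Maybe using (just; nothing)
open import Data.Nat as ℕ using (ℕ; zero; suc; _∸_; _<_; _≥_; z≤n; s≤s)
import Data.Nat.Divisibility as ℕ
open import Data.Nat.Induction using (<-rec)
import Data.Nat.Properties as ℕ
import Data.Nat.Tactic.RingSolver as ℕ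
open import Data.Product using (_,_)
open import Data.Sum using (inj₁; inj₂)
open import Function using (_∘_)
open import Relation.Binary.Bundles using (Setoid)
open import Relation.Binary.Definitions using (WeaklyDecidable)
open import Relation.Binary.PropositionalEquality
import Relation.Binary.Reasoning.Setoid as SetoidReasoning
open import Relation.Nullary using (¬_; yes; no; contradiction)
open import Relation.Nullary.Decidable using (False; toWitnessFalse)

-- The ring ℤ[[x]]

infix  4 _≈_
infixl 6 _+ₛ_ _-ₛ_
infixl 7 _*ₛ_
infix  8 -ₛ_

_≈_ : PowerSeries → PowerSeries → Set
a ≈ b = ∀ n → a n ≡ b n

tail : PowerSeries → PowerSeries
tail a n = a (suc n)

const : ℤ → PowerSeries
const c zero    = c
const c (suc n) = 0ℤ

0ₛ 1ₛ : PowerSeries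
0ₛ n = 0ℤ
1ₛ   = const (+ 1)

_+ₛ_ : PowerSeries → PowerSeries → PowerSeries
(a +ₛ b) n = a n + b n

-ₛ_ : PowerSeries → PowerSeries
(-ₛ a) n = - a n

_-ₛ_ : PowerSeries → PowerSeries → PowerSeries
a -ₛ b = a +ₛ -ₛ b

scale : ℤ → PowerSeries → PowerSeries
scale c a n = c * a n

-- Recursion on the first factor makes the ring laws provable by induction on the degree.
_*ₛ_ : PowerSeries → PowerSeries → PowerSeries
(a *ₛ b) zero    = a 0 * b 0
(a *ₛ b) (suc n) = a 0 * b (suc n) + (tail a *ₛ b) n

cube : PowerSeries → PowerSeries
cube a = a *ₛ a *ₛ a

*ₛ-cong : ∀ {a a′ b b′} → a ≈ a′ → b ≈ b′ → a *ₛ b ≈ a′ *ₛ b′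
*ₛ-cong a≈a′ b≈b′ zero    = cong₂ _*_ (a≈a′ 0) (b≈b′ 0)
*ₛ-cong a≈a′ b≈b′ (suc n) =
  cong₂ _+_ (cong₂ _*_ (a≈a′ 0) (b≈b′ (suc n))) (*ₛ-cong (a≈a′ ∘ suc) b≈b′ n)

*ₛ-zeroˡ : ∀ a → 0ₛ *ₛ a ≈ 0ₛ
*ₛ-zeroˡ a zero    = refl
*ₛ-zeroˡ a (suc n) = trans (ℤ.+-identityˡ _) (*ₛ-zeroˡ a n)

const-*ₛ : ∀ c a → const c *ₛ a ≈ scale c a
const-*ₛ c a zero    = refl
const-*ₛ c a (suc n) = begin
  c * a (suc n) + (0ₛ *ₛ a) n  ≡⟨ cong (_+_ (c * a (suc n))) (*ₛ-zeroˡ a n) ⟩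
  c * a (suc n) + 0ℤ           ≡⟨ ℤ.+-identityʳ _ ⟩
  c * a (suc n)                ∎
  where open ≡-Reasoning

scale-*ₛ : ∀ c a b → scale c a *ₛ b ≈ scale c (a *ₛ b)
scale-*ₛ c a b zero    = ℤ.*-assoc c (a 0) (b 0)
scale-*ₛ c a b (suc n) = begin
  c * a 0 * b (suc n) + (scale c (tail a) *ₛ b) n
    ≡⟨ cong₂ _+_ (ℤ.*-assoc c (a 0) (b (suc n))) (scale-*ₛ c (tail a) b n) ⟩
  c * (a 0 * b (suc n)) + c * (tail a *ₛ b) n
    ≡⟨ ℤ.*-distribˡ-+ c _ _ ⟨
  c * (a 0 * b (suc n) + (tail a *ₛ b) n)
    ∎
  where open ≡-Reasoning

*ₛ-distribʳ : ∀ a b c → (a +ₛ b) *ₛ c ≈ a *ₛ c +ₛ b *ₛ c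
*ₛ-distribʳ a b c zero    = ℤ.*-distribʳ-+ (c 0) (a 0) (b 0)
*ₛ-distribʳ a b c (suc n) = begin
  (a 0 + b 0) * c (suc n) + ((tail a +ₛ tail b) *ₛ c) n
    ≡⟨ cong₂ _+_ (ℤ.*-distribʳ-+ (c (suc n)) (a 0) (b 0)) (*ₛ-distribʳ (tail a) (tail b) c n) ⟩
  (a 0 * c (suc n) + b 0 * c (suc n)) + ((tail a *ₛ c) n + (tail b *ₛ c) n)
    ≡⟨ +-interchange (a 0 * c (suc n)) _ _ _ ⟩
  (a 0 * c (suc n) + (tail a *ₛ c) n) + (b 0 * c (suc n) + (tail b *ₛ c) n)
    ∎
  where open ≡-Reasoning

*ₛ-unfoldʳ : ∀ a b n → (a *ₛ b) (suc n) ≡ (a *ₛ tail b) n + a (suc n) * b 0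
*ₛ-unfoldʳ a b zero    = refl
*ₛ-unfoldʳ a b (suc n) = begin
  a 0 * b (suc (suc n)) + (tail a *ₛ b) (suc n)
    ≡⟨ cong (_+_ (a 0 * b (suc (suc n)))) (*ₛ-unfoldʳ (tail a) b n) ⟩
  a 0 * b (suc (suc n)) + ((tail a *ₛ tail b) n + a (suc (suc n)) * b 0)
    ≡⟨ ℤ.+-assoc (a 0 * b (suc (suc n))) _ _ ⟨
  a 0 * b (suc (suc n)) + (tail a *ₛ tail b) n + a (suc (suc n)) * b 0
    ∎
  where open ≡-Reasoning

*ₛ-comm : ∀ a b → a *ₛ b ≈ b *ₛ a
*ₛ-comm a b zero    = ℤ.*-comm (a 0) (b 0)
*ₛ-comm a b (suc n) = begin
  a 0 * b (suc n) + (tail a *ₛ b) n  ≡⟨ cong₂ _+_ (ℤ.*-comm (a 0) (b (suc n))) (*ₛ-comm (tail a) b n) ⟩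
  b (suc n) * a 0 + (b *ₛ tail a) n  ≡⟨ ℤ.+-comm (b (suc n) * a 0) _ ⟩
  (b *ₛ tail a) n + b (suc n) * a 0  ≡⟨ *ₛ-unfoldʳ b a n ⟨
  (b *ₛ a) (suc n)                   ∎
  where open ≡-Reasoning

*ₛ-assoc : ∀ a b c → (a *ₛ b) *ₛ c ≈ a *ₛ (b *ₛ c)
*ₛ-assoc a b c zero    = ℤ.*-assoc (a 0) (b 0) (c 0)
*ₛ-assoc a b c (suc n) = begin
  a 0 * b 0 * c (suc n) + ((scale (a 0) (tail b) +ₛ tail a *ₛ b) *ₛ c) n
    ≡⟨ cong (_+_ (a 0 * b 0 * c (suc n))) (*ₛ-distribʳ (scale (a 0) (tail b)) (tail a *ₛ b) c n) ⟩
  a 0 * b 0 * c (suc n) + ((scale (a 0) (tail b) *ₛ c) n + ((tail a *ₛ b) *ₛ c) n)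
    ≡⟨ cong (_+_ (a 0 * b 0 * c (suc n))) (cong₂ _+_ (scale-*ₛ (a 0) (tail b) c n) (*ₛ-assoc (tail a) b c n)) ⟩
  a 0 * b 0 * c (suc n) + (a 0 * (tail b *ₛ c) n + (tail a *ₛ (b *ₛ c)) n)
    ≡⟨ ℤ.+-assoc (a 0 * b 0 * c (suc n)) _ _ ⟨
  a 0 * b 0 * c (suc n) + a 0 * (tail b *ₛ c) n + (tail a *ₛ (b *ₛ c)) n
    ≡⟨ cong (_+ (tail a *ₛ (b *ₛ c)) n) (trans
         (cong (_+ a 0 * (tail b *ₛ c) n) (ℤ.*-assoc (a 0) (b 0) (c (suc n))))
         (sym (ℤ.*-distribˡ-+ (a 0) _ _))) ⟩
  a 0 * (b 0 * c (suc n) + (tail b *ₛ c) n) + (tail a *ₛ (b *ₛ c)) n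
    ∎
  where open ≡-Reasoning

*ₛ-identityˡ : ∀ a → 1ₛ *ₛ a ≈ a
*ₛ-identityˡ a n = trans (const-*ₛ (+ 1) a n) (ℤ.*-identityˡ (a n))

*ₛ-identityʳ : ∀ a → a *ₛ 1ₛ ≈ a
*ₛ-identityʳ a n = trans (*ₛ-comm a 1ₛ n) (*ₛ-identityˡ a n)

*ₛ-distribˡ : ∀ a b c → a *ₛ (b +ₛ c) ≈ a *ₛ b +ₛ a *ₛ c
*ₛ-distribˡ a b c n = begin
  (a *ₛ (b +ₛ c)) n          ≡⟨ *ₛ-comm a (b +ₛ c) n ⟩
  ((b +ₛ c) *ₛ a) n          ≡⟨ *ₛ-distribʳ b c a n ⟩
  (b *ₛ a) n + (c *ₛ a) n    ≡⟨ cong₂ _+_ (*ₛ-comm b a n) (*ₛ-comm c a n) ⟩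
  (a *ₛ b) n + (a *ₛ c) n    ∎
  where open ≡-Reasoning

powerSeriesRing : CommutativeRing _ _
powerSeriesRing = record
  { isCommutativeRing = record
    { isRing = record
      { +-isAbelianGroup = Pointwise.isAbelianGroup ℕ ℤ.+-0-isAbelianGroup
      ; *-cong           = *ₛ-cong
      ; *-assoc          = *ₛ-assoc
      ; *-identity       = *ₛ-identityˡ , *ₛ-identityʳ
      ; distrib          = *ₛ-distribˡ , λ c a b → *ₛ-distribʳ a b c
      }
    ; *-comm = *ₛ-comm
    }
  }

const-*ₛ-const : ∀ c d → const c *ₛ const d ≈ const (c * d)
const-*ₛ-const c d zero    = refl
const-*ₛ-const c d (suc n) = trans (const-*ₛ c (const d) (suc n)) (ℤ.*-zeroʳ c)

const-cube : ∀ c → cube (const c) ≈ const (c * c * c)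
const-cube c n = trans (*ₛ-cong (const-*ₛ-const c c) (λ _ → refl) n) (const-*ₛ-const (c * c) c n)

const-homomorphism : ℤ.+-*-rawRing -Raw-AlmostCommutative⟶ fromCommutativeRing powerSeriesRing
const-homomorphism = record
  { ⟦_⟧    = const
  ; +-homo = λ { c d zero → refl ; c d (suc n) → refl }
  ; *-homo = λ c d n → sym (const-*ₛ-const c d n)
  ; -‿homo = λ { c zero → refl ; c (suc n) → refl }
  ; 0-homo = λ { zero → refl ; (suc n) → refl }
  ; 1-homo = λ { zero → refl ; (suc n) → refl }
  }

const-≟ : WeaklyDecidable (Induced-equivalence const-homomorphism)
const-≟ c d with c ℤ.≟ d
... | yes refl = just (λ _ → refl)
... | no _     = nothing

open import Algebra.Solver.Ring ℤ.+-*-rawRing (fromCommutativeRing powerSeriesRing)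
  const-homomorphism const-≟ using (solve; _:=_; _:+_; _:-_; _:*_; con)

-- Defs keeps the partial sums of _·ₚ_ private. The body of partialConv is a metavariable,
-- solved by the refl in ·ₚ-suc: abstracting suc n and _+_ there turns the unfolding of
-- _·ₚ_ into a pattern unification problem.
mutual
  partialConv : PowerSeries → PowerSeries → ℕ → ℕ → ℤ
  partialConv = _

  ·ₚ-suc : ∀ a b n → (a ·ₚ b) (suc n) ≡ partialConv a b (suc n) n + a (suc n) * b (n ∸ n)
  ·ₚ-suc a b n with suc n | _+_
  ... | _ | _ = refl

partialConv-suc : ∀ a b n k →
  partialConv a b (suc n) (suc k) ≡ a 0 * b (suc n) + partialConv (tail a) b n k
partialConv-suc a b n zero    = refl
partialConv-suc a b n (suc k) = begin
  partialConv a b (suc n) (suc k) + a (suc (suc k)) * b (n ∸ suc k)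
    ≡⟨ cong (_+ a (suc (suc k)) * b (n ∸ suc k)) (partialConv-suc a b n k) ⟩
  a 0 * b (suc n) + partialConv (tail a) b n k + a (suc (suc k)) * b (n ∸ suc k)
    ≡⟨ ℤ.+-assoc (a 0 * b (suc n)) _ _ ⟩
  a 0 * b (suc n) + partialConv (tail a) b n (suc k)
    ∎
  where open ≡-Reasoning

·ₚ≈*ₛ : ∀ a b → a ·ₚ b ≈ a *ₛ b
·ₚ≈*ₛ a b zero    = refl
·ₚ≈*ₛ a b (suc n) = begin
  (a ·ₚ b) (suc n)                                       ≡⟨ ·ₚ-suc a b n ⟩
  partialConv a b (suc n) n + a (suc n) * b (n ∸ n)      ≡⟨ partialConv-suc a b n n ⟩
  a 0 * b (suc n) + (tail a ·ₚ b) n                      ≡⟨ cong (_+_ (a 0 * b (suc n))) (·ₚ≈*ₛ (tail a) b n) ⟩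
  (a *ₛ b) (suc n)                                       ∎
  where open ≡-Reasoning

cube-·ₚ : ∀ a → (a ·ₚ a) ·ₚ a ≈ cube a
cube-·ₚ a n = trans (·ₚ≈*ₛ (a ·ₚ a) a n) (*ₛ-cong (·ₚ≈*ₛ a a) (λ _ → refl) n)

infix 10 X^_

X^_ : ℕ → PowerSeries
(X^ zero)  n       = 1ₛ n
(X^ suc q) zero    = 0ℤ
(X^ suc q) (suc n) = (X^ q) n

X^-*ₛ : ∀ q a m → (X^ q *ₛ a) (q ℕ.+ m) ≡ a m
X^-*ₛ zero    a m = *ₛ-identityˡ a m
X^-*ₛ (suc q) a m = trans (ℤ.+-identityˡ _) (X^-*ₛ q a m)

const-head+X*tail : ∀ a → a ≈ const (a 0) +ₛ X^ 1 *ₛ tail a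
const-head+X*tail a zero    = sym (ℤ.+-identityʳ (a 0))
const-head+X*tail a (suc n) = sym (trans (ℤ.+-identityˡ _) (X^-*ₛ 1 (tail a) n))

VanishesFrom : ℕ → PowerSeries → Set
VanishesFrom d a = ∀ m → a (d ℕ.+ m) ≡ 0ℤ

*ₛ-vanishes : ∀ d e {a b} → VanishesFrom d a → VanishesFrom e b → VanishesFrom (d ℕ.+ e) (a *ₛ b)
*ₛ-vanishes zero    e {a} {b} a≈0 _ m = trans (*ₛ-cong a≈0 (λ _ → refl) (e ℕ.+ m)) (*ₛ-zeroˡ b (e ℕ.+ m))
*ₛ-vanishes (suc d) e {a} {b} a↑ b↑ m = begin
  a 0 * b (suc (d ℕ.+ e ℕ.+ m)) + (tail a *ₛ b) (d ℕ.+ e ℕ.+ m)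
    ≡⟨ cong₂ _+_ (cong (a 0 *_) (trans (cong b (index d e m)) (b↑ (suc (d ℕ.+ m)))))
                 (*ₛ-vanishes d e a↑ b↑ m) ⟩
  a 0 * 0ℤ + 0ℤ
    ≡⟨ cong (_+ 0ℤ) (ℤ.*-zeroʳ (a 0)) ⟩
  0ℤ
    ∎
  where
  open ≡-Reasoning
  index : ∀ d e m → suc (d ℕ.+ e ℕ.+ m) ≡ e ℕ.+ suc (d ℕ.+ m)
  index = ℕ.solve-∀

truncate : ℕ → PowerSeries → PowerSeries
truncate zero    a n       = 0ℤ
truncate (suc d) a zero    = a 0
truncate (suc d) a (suc n) = truncate d (tail a) n

truncate-vanishes : ∀ d a → VanishesFrom d (truncate d a)
truncate-vanishes zero    a m = refl
truncate-vanishes (suc d) a m = truncate-vanishes d (tail a) m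

-- Congruences

infix 4 _≡_mod_ _≈_mod_

-- A record, not a definition, so that x and y can be inferred from a proof.
record _≡_mod_ (x y k : ℤ) : Set where
  constructor congruent
  field k∣x-y : k ∣ x - y

open _≡_mod_

_≈_mod_ : PowerSeries → PowerSeries → ℤ → Set
_≈_mod_ a b k = ∀ n → a n ≡ b n mod k

≡mod-refl : ∀ {k} x → x ≡ x mod k
≡mod-refl x = congruent (divides 0ℤ (ℤ.+-inverseʳ x))

≡mod-reflexive : ∀ {k x y} → x ≡ y → x ≡ y mod k
≡mod-reflexive {x = x} refl = ≡mod-refl x

≡mod-sym : ∀ {k x y} → x ≡ y mod k → y ≡ x mod k
≡mod-sym {k} {x} {y} (congruent k∣x-y) = congruent (subst (k ∣_) (negate x y) (∣m⇒∣-m k∣x-y))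
  where
  negate : ∀ x y → - (x - y) ≡ y - x
  negate = solve-∀

≡mod-trans : ∀ {k x y z} → x ≡ y mod k → y ≡ z mod k → x ≡ z mod k
≡mod-trans {k} {x} {y} {z} (congruent k∣x-y) (congruent k∣y-z) =
  congruent (subst (k ∣_) (telescope x y z) (∣m∣n⇒∣m+n k∣x-y k∣y-z))
  where
  telescope : ∀ x y z → (x - y) + (y - z) ≡ x - z
  telescope = solve-∀

≡mod-+multiple : ∀ {k x y} z → x ≡ y mod k → x + k * z ≡ y mod k
≡mod-+multiple {k} {x} {y} z (congruent k∣x-y) =
  congruent (subst (k ∣_) (regroup k x y z) (∣m∣n⇒∣m+n k∣x-y (∣n⇒∣m*n z (∣-refl {k}))))
  where
  regroup : ∀ k x y z → x - y + z * k ≡ x + k * z - y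
  regroup = solve-∀

≡mod-witness : ∀ {k x y} (x≡y : x ≡ y mod k) → x ≡ y + k * quotient (k∣x-y x≡y)
≡mod-witness {k} {x} {y} (congruent (divides q x-y≡q*k)) = begin
  x             ≡⟨ y+[x-y] x y ⟨
  y + (x - y)   ≡⟨ cong (_+_ y) x-y≡q*k ⟩
  y + q * k     ≡⟨ cong (_+_ y) (ℤ.*-comm q k) ⟩
  y + k * q     ∎
  where
  open ≡-Reasoning
  y+[x-y] : ∀ x y → y + (x - y) ≡ x
  y+[x-y] = solve-∀

≡mod-setoid : ℤ → Setoid _ _
≡mod-setoid k = record
  { _≈_           = λ x y → x ≡ y mod k
  ; isEquivalence = record { refl = ≡mod-refl _ ; sym = ≡mod-sym ; trans = ≡mod-trans }
  }

module ≡mod-Reasoning (k : ℤ) = SetoidReasoning (≡mod-setoid k)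

cube≡mod3⁺ : ∀ n → + n * + n * + n ≡ + n mod + 3
cube≡mod3⁺ zero    = ≡mod-refl 0ℤ
cube≡mod3⁺ (suc n) = congruent (subst (+ 3 ∣_) (step (+ n))
  (∣m∣n⇒∣m+n (k∣x-y (cube≡mod3⁺ n)) (∣n⇒∣m*n (+ n * (+ n + + 1)) ∣-refl)))
  where
  step : ∀ z → z * z * z - z + z * (z + + 1) * + 3 ≡ (+ 1 + z) * (+ 1 + z) * (+ 1 + z) - (+ 1 + z)
  step = solve-∀

cube≡mod3 : ∀ z → z * z * z ≡ z mod + 3
cube≡mod3 (+ n)    = cube≡mod3⁺ n
cube≡mod3 -[1+ n ] = congruent (subst (+ 3 ∣_) (odd (+ suc n)) (∣m⇒∣-m (k∣x-y (cube≡mod3⁺ (suc n)))))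
  where
  odd : ∀ z → - (z * z * z - z) ≡ (- z) * (- z) * (- z) - (- z)
  odd = solve-∀

dilate₃ : PowerSeries → PowerSeries
dilate₃ a zero                = a 0
dilate₃ a (suc zero)          = 0ℤ
dilate₃ a (suc (suc zero))    = 0ℤ
dilate₃ a (suc (suc (suc n))) = dilate₃ (tail a) n

dilate₃-*3 : ∀ a m → dilate₃ a (m ℕ.* 3) ≡ a m
dilate₃-*3 a zero    = refl
dilate₃-*3 a (suc m) = dilate₃-*3 (tail a) m

dilate₃-∤ : ∀ a n → ¬ 3 ℕ.∣ n → dilate₃ a n ≡ 0ℤ
dilate₃-∤ a zero                3∤n = contradiction (3 ℕ.∣0) 3∤n
dilate₃-∤ a (suc zero)          _   = refl
dilate₃-∤ a (suc (suc zero))    _   = refl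
dilate₃-∤ a (suc (suc (suc n))) 3∤n = dilate₃-∤ (tail a) n (3∤n ∘ ℕ.∣m∣n⇒∣m+n ℕ.∣-refl)

cube-[c+xh] : ∀ c x h → cube (c +ₛ x *ₛ h) ≈
  cube c +ₛ x *ₛ (x *ₛ (x *ₛ cube h)) +ₛ const (+ 3) *ₛ (c *ₛ x *ₛ h *ₛ (c +ₛ x *ₛ h))
cube-[c+xh] = solve 3 (λ c x h →
  (c :+ x :* h) :* (c :+ x :* h) :* (c :+ x :* h) :=
  c :* c :* c :+ x :* (x :* (x :* (h :* h :* h))) :+ con (+ 3) :* (c :* x :* h :* (c :+ x :* h)))
  (λ _ → refl)

-- For a = c + x h: (c + x h)³ ≡ c³ + x³ h³ (mod 3), and c³ ≡ c.
cube≡dilate₃ : ∀ a → cube a ≈ dilate₃ a mod + 3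
cube≡dilate₃ a zero    = cube≡mod3 (a 0)
cube≡dilate₃ a (suc n) = begin
  cube a (suc n)
    ≡⟨ *ₛ-cong (*ₛ-cong a≈ a≈) a≈ (suc n) ⟩
  cube (const (a 0) +ₛ x *ₛ h) (suc n)
    ≡⟨ cube-[c+xh] (const (a 0)) x h (suc n) ⟩
  cube (const (a 0)) (suc n) + T (suc n) + (const (+ 3) *ₛ Y) (suc n)
    ≡⟨ cong (λ t → t + T (suc n) + (const (+ 3) *ₛ Y) (suc n)) (const-cube (a 0) (suc n)) ⟩
  0ℤ + T (suc n) + (const (+ 3) *ₛ Y) (suc n)
    ≡⟨ cong₂ _+_ (ℤ.+-identityˡ (T (suc n))) (const-*ₛ (+ 3) Y (suc n)) ⟩
  T (suc n) + + 3 * Y (suc n)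
    ≈⟨ ≡mod-+multiple (Y (suc n)) (≡mod-refl (T (suc n))) ⟩
  T (suc n)
    ≈⟨ T≡dilate₃ n ⟩
  dilate₃ a (suc n)
    ∎
  where
  open ≡mod-Reasoning (+ 3)
  x h Y T : PowerSeries
  x = X^ 1
  h = tail a
  Y = const (a 0) *ₛ x *ₛ h *ₛ (const (a 0) +ₛ x *ₛ h)
  T = x *ₛ (x *ₛ (x *ₛ cube h))

  a≈ : a ≈ const (a 0) +ₛ x *ₛ h
  a≈ = const-head+X*tail a

  T≡dilate₃ : ∀ n → T (suc n) ≡ dilate₃ a (suc n) mod + 3
  T≡dilate₃ zero          = ≡mod-reflexive (X^-*ₛ 1 (x *ₛ (x *ₛ cube h)) 0)
  T≡dilate₃ (suc zero)    = ≡mod-reflexive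
    (trans (X^-*ₛ 1 (x *ₛ (x *ₛ cube h)) 1) (X^-*ₛ 1 (x *ₛ cube h) 0))
  T≡dilate₃ (suc (suc m)) = ≡mod-trans
    (≡mod-reflexive (trans (X^-*ₛ 1 (x *ₛ (x *ₛ cube h)) (2 ℕ.+ m))
                    (trans (X^-*ₛ 1 (x *ₛ cube h) (1 ℕ.+ m)) (X^-*ₛ 1 (cube h) m))))
    (cube≡dilate₃ h m)

cube-[b+3c] : ∀ b c → cube (b +ₛ const (+ 3) *ₛ c) ≈
  cube b +ₛ const (+ 9) *ₛ (b *ₛ b *ₛ c +ₛ const (+ 3) *ₛ (b *ₛ c *ₛ c) +ₛ const (+ 3) *ₛ cube c)
cube-[b+3c] = solve 2 (λ b c →
  (b :+ con (+ 3) :* c) :* (b :+ con (+ 3) :* c) :* (b :+ con (+ 3) :* c) :=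
  b :* b :* b :+ con (+ 9) :* (b :* b :* c :+ con (+ 3) :* (b :* c :* c) :+ con (+ 3) :* (c :* c :* c)))
  (λ _ → refl)

≈mod3⇒cube≈mod9 : ∀ {a b} → a ≈ b mod + 3 → cube a ≈ cube b mod + 9
≈mod3⇒cube≈mod9 {a} {b} a≡b n = begin
  cube a n                         ≡⟨ *ₛ-cong (*ₛ-cong a≈ a≈) a≈ n ⟩
  cube (b +ₛ const (+ 3) *ₛ c) n   ≡⟨ cube-[b+3c] b c n ⟩
  cube b n + (const (+ 9) *ₛ W) n  ≡⟨ cong (_+_ (cube b n)) (const-*ₛ (+ 9) W n) ⟩
  cube b n + + 9 * W n             ≈⟨ ≡mod-+multiple (W n) (≡mod-refl (cube b n)) ⟩
  cube b n                         ∎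
  where
  open ≡mod-Reasoning (+ 9)
  c W : PowerSeries
  c n = quotient (k∣x-y (a≡b n))
  W = b *ₛ b *ₛ c +ₛ const (+ 3) *ₛ (b *ₛ c *ₛ c) +ₛ const (+ 3) *ₛ cube c
  a≈ : a ≈ b +ₛ const (+ 3) *ₛ c
  a≈ n = trans (≡mod-witness (a≡b n)) (cong (_+_ (b n)) (sym (const-*ₛ (+ 3) c n)))

≈truncate-mod : ∀ {k} d a → (∀ m → k ∣ a (d ℕ.+ m)) → a ≈ truncate d a mod k
≈truncate-mod zero    a k∣a n       = congruent (subst (_ ∣_) (sym (ℤ.+-identityʳ (a n))) (k∣a n))
≈truncate-mod (suc d) a k∣a zero    = ≡mod-refl (a 0)
≈truncate-mod (suc d) a k∣a (suc n) = ≈truncate-mod d (tail a) k∣a n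

cube-[a-sa] : ∀ a s → cube (a -ₛ s *ₛ a) ≈ cube (1ₛ -ₛ s) *ₛ cube a
cube-[a-sa] = solve 2 (λ a s →
  (a :- s :* a) :* (a :- s :* a) :* (a :- s :* a) :=
  (con (+ 1) :- s) :* (con (+ 1) :- s) :* (con (+ 1) :- s) :* (a :* a :* a))
  (λ _ → refl)

[1-s]³-expand : ∀ s b → cube (1ₛ -ₛ s) *ₛ b ≈
  b -ₛ const (+ 3) *ₛ (s *ₛ b) +ₛ const (+ 3) *ₛ (s *ₛ (s *ₛ b)) -ₛ s *ₛ (s *ₛ (s *ₛ b))
[1-s]³-expand = solve 2 (λ s b →
  (con (+ 1) :- s) :* (con (+ 1) :- s) :* (con (+ 1) :- s) :* b :=
  b :- con (+ 3) :* (s :* b) :+ con (+ 3) :* (s :* (s :* b)) :- s :* (s :* (s :* b)))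
  (λ _ → refl)

[1-Xᵠ]³-coeff : ∀ q b m → let n₁ = q ℕ.+ m; n₂ = q ℕ.+ n₁; n₃ = q ℕ.+ n₂ in
  (cube (1ₛ -ₛ X^ q) *ₛ b) n₃ ≡ b n₃ - + 3 * b n₂ + + 3 * b n₁ - b m
[1-Xᵠ]³-coeff q b m = begin
  (cube (1ₛ -ₛ s) *ₛ b) n₃
    ≡⟨ [1-s]³-expand s b n₃ ⟩
  b n₃ - (const (+ 3) *ₛ (s *ₛ b)) n₃ + (const (+ 3) *ₛ (s *ₛ (s *ₛ b))) n₃ - (s *ₛ (s *ₛ (s *ₛ b))) n₃
    ≡⟨ cong₂ _-_ (cong₂ _+_ (cong (_-_ (b n₃)) (thrice shift¹)) (thrice shift²)) shift³ ⟩
  b n₃ - + 3 * b n₂ + + 3 * b n₁ - b m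
    ∎
  where
  open ≡-Reasoning
  s : PowerSeries
  s = X^ q
  n₁ n₂ n₃ : ℕ
  n₁ = q ℕ.+ m
  n₂ = q ℕ.+ n₁
  n₃ = q ℕ.+ n₂
  shift¹ : (s *ₛ b) n₃ ≡ b n₂
  shift¹ = X^-*ₛ q b n₂
  shift² : (s *ₛ (s *ₛ b)) n₃ ≡ b n₁
  shift² = trans (X^-*ₛ q (s *ₛ b) n₂) (X^-*ₛ q b n₁)
  shift³ : (s *ₛ (s *ₛ (s *ₛ b))) n₃ ≡ b m
  shift³ = trans (X^-*ₛ q (s *ₛ (s *ₛ b)) n₂) (trans (X^-*ₛ q (s *ₛ b) n₁) (X^-*ₛ q b m))
  thrice : ∀ {c x} → c n₃ ≡ x → (const (+ 3) *ₛ c) n₃ ≡ + 3 * x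
  thrice {c} c≡x = trans (const-*ₛ (+ 3) c n₃) (cong (+ 3 *_) c≡x)

≢mod3 : ∀ {x y} {_ : False (+ 3 ∣? x - y)} → ¬ x ≡ y mod + 3
≢mod3 {_} {_} {3∤x-y} (congruent 3∣x-y) = toWitnessFalse 3∤x-y 3∣x-y

In123-≡mod3⇒≡ : ∀ {x y} → In123 x → In123 y → x ≡ y mod + 3 → x ≡ y
In123-≡mod3⇒≡ (inj₁ refl)        (inj₁ refl)        _   = refl
In123-≡mod3⇒≡ (inj₁ refl)        (inj₂ (inj₁ refl)) x≡y = contradiction x≡y ≢mod3
In123-≡mod3⇒≡ (inj₁ refl)        (inj₂ (inj₂ refl)) x≡y = contradiction x≡y ≢mod3
In123-≡mod3⇒≡ (inj₂ (inj₁ refl)) (inj₁ refl)        x≡y = contradiction x≡y ≢mod3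
In123-≡mod3⇒≡ (inj₂ (inj₁ refl)) (inj₂ (inj₁ refl)) _   = refl
In123-≡mod3⇒≡ (inj₂ (inj₁ refl)) (inj₂ (inj₂ refl)) x≡y = contradiction x≡y ≢mod3
In123-≡mod3⇒≡ (inj₂ (inj₂ refl)) (inj₁ refl)        x≡y = contradiction x≡y ≢mod3
In123-≡mod3⇒≡ (inj₂ (inj₂ refl)) (inj₂ (inj₁ refl)) x≡y = contradiction x≡y ≢mod3
In123-≡mod3⇒≡ (inj₂ (inj₂ refl)) (inj₂ (inj₂ refl)) _   = refl

-- Periods of f

IsPeriod : PowerSeries → ℕ → Set
IsPeriod f π = ∀ n → f (n ℕ.+ π) ≡ f n

module _ {f g : PowerSeries} (f≈g³ : f ≈ cube g) where

  f≡dilate₃ : f ≈ dilate₃ g mod + 3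
  f≡dilate₃ n = subst (λ t → t ≡ dilate₃ g n mod + 3) (sym (f≈g³ n)) (cube≡dilate₃ g n)

  3∣period : f 0 ≡ + 1 → ∀ {π} → IsPeriod f π → 3 ℕ.∣ π
  3∣period f0≡1 {π} per with 3 ℕ.∣? π
  ... | yes 3∣π = 3∣π
  ... | no  3∤π = contradiction 1≡0 ≢mod3
    where
    1≡0 : + 1 ≡ 0ℤ mod + 3
    1≡0 = subst₂ (λ x y → x ≡ y mod + 3) (trans (per 0) f0≡1) (dilate₃-∤ g π 3∤π) (f≡dilate₃ π)

  module _ (digit : ∀ n → In123 (f n)) (q : ℕ) (per : IsPeriod f (q ℕ.* 3)) where

    g-periodic-mod3 : ∀ m → g (q ℕ.+ m) ≡ g m mod + 3
    g-periodic-mod3 m = begin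
      g (q ℕ.+ m)                   ≡⟨ dilate₃-*3 g (q ℕ.+ m) ⟨
      dilate₃ g ((q ℕ.+ m) ℕ.* 3)   ≈⟨ f≡dilate₃ _ ⟨
      f ((q ℕ.+ m) ℕ.* 3)           ≡⟨ cong f (index q m) ⟩
      f (m ℕ.* 3 ℕ.+ q ℕ.* 3)       ≡⟨ per (m ℕ.* 3) ⟩
      f (m ℕ.* 3)                   ≈⟨ f≡dilate₃ _ ⟩
      dilate₃ g (m ℕ.* 3)           ≡⟨ dilate₃-*3 g m ⟩
      g m                           ∎
      where
      open ≡mod-Reasoning (+ 3)
      index : ∀ q m → (q ℕ.+ m) ℕ.* 3 ≡ m ℕ.* 3 ℕ.+ q ℕ.* 3
      index = ℕ.solve-∀

    u : PowerSeries
    u = g -ₛ X^ q *ₛ g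

    3∣u : ∀ m → + 3 ∣ u (q ℕ.+ m)
    3∣u m = subst (λ t → + 3 ∣ g (q ℕ.+ m) - t) (sym (X^-*ₛ q g m)) (k∣x-y (g-periodic-mod3 m))

    9∣cube-u : ∀ m → + 9 ∣ cube u (q ℕ.+ (q ℕ.+ (q ℕ.+ m)))
    9∣cube-u m = subst (+ 9 ∣_) (trans (cong (_-_ (cube u n)) A³-vanishes) (ℤ.+-identityʳ (cube u n)))
      (k∣x-y (≈mod3⇒cube≈mod9 (≈truncate-mod q u 3∣u) n))
      where
      n : ℕ
      n = q ℕ.+ (q ℕ.+ (q ℕ.+ m))
      A : PowerSeries
      A = truncate q u
      A↑ : VanishesFrom q A
      A↑ = truncate-vanishes q u
      index : ∀ q m → q ℕ.+ (q ℕ.+ (q ℕ.+ m)) ≡ q ℕ.+ q ℕ.+ q ℕ.+ m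
      index = ℕ.solve-∀
      A³-vanishes : cube A n ≡ 0ℤ
      A³-vanishes = trans (cong (cube A) (index q m)) (*ₛ-vanishes (q ℕ.+ q) q (*ₛ-vanishes q q A↑ A↑) A↑ m)

    f[q+m]≡f[q+q+m] : ∀ m → f (q ℕ.+ m) ≡ f (q ℕ.+ (q ℕ.+ m))
    f[q+m]≡f[q+q+m] m = In123-≡mod3⇒≡ (digit _) (digit _)
      (congruent (*-cancelˡ-∣ (+ 3) {+ 3} (subst (+ 9 ∣_) cube-u≡ (9∣cube-u m))))
      where
      open ≡-Reasoning
      n : ℕ
      n = q ℕ.+ (q ℕ.+ (q ℕ.+ m))
      index : ∀ q m → q ℕ.+ (q ℕ.+ (q ℕ.+ m)) ≡ m ℕ.+ q ℕ.* 3
      index = ℕ.solve-∀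
      alternating : ∀ x y z → x - + 3 * y + + 3 * z - x ≡ + 3 * (z - y)
      alternating = solve-∀
      cube-u≡ : cube u n ≡ + 3 * (f (q ℕ.+ m) - f (q ℕ.+ (q ℕ.+ m)))
      cube-u≡ = begin
        cube u n
          ≡⟨ cube-[a-sa] g (X^ q) n ⟩
        (cube (1ₛ -ₛ X^ q) *ₛ cube g) n
          ≡⟨ *ₛ-cong (λ _ → refl) (sym ∘ f≈g³) n ⟩
        (cube (1ₛ -ₛ X^ q) *ₛ f) n
          ≡⟨ [1-Xᵠ]³-coeff q f m ⟩
        f n - + 3 * f (q ℕ.+ (q ℕ.+ m)) + + 3 * f (q ℕ.+ m) - f m
          ≡⟨ cong (λ t → t - + 3 * f (q ℕ.+ (q ℕ.+ m)) + + 3 * f (q ℕ.+ m) - f m)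
                  (trans (cong f (index q m)) (per m)) ⟩
        f m - + 3 * f (q ℕ.+ (q ℕ.+ m)) + + 3 * f (q ℕ.+ m) - f m
          ≡⟨ alternating (f m) _ _ ⟩
        + 3 * (f (q ℕ.+ m) - f (q ℕ.+ (q ℕ.+ m)))
          ∎

    period/3 : IsPeriod f q
    period/3 j = begin
      f (j ℕ.+ q)                            ≡⟨ per (j ℕ.+ q) ⟨
      f (j ℕ.+ q ℕ.+ q ℕ.* 3)                ≡⟨ cong f (index₁ j q) ⟩
      f (q ℕ.+ (q ℕ.+ (j ℕ.+ (q ℕ.+ q))))    ≡⟨ f[q+m]≡f[q+q+m] (j ℕ.+ (q ℕ.+ q)) ⟨
      f (q ℕ.+ (j ℕ.+ (q ℕ.+ q)))            ≡⟨ cong f (index₂ j q) ⟩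
      f (j ℕ.+ q ℕ.* 3)                      ≡⟨ per j ⟩
      f j                                    ∎
      where
      open ≡-Reasoning
      index₁ : ∀ j q → j ℕ.+ q ℕ.+ q ℕ.* 3 ≡ q ℕ.+ (q ℕ.+ (j ℕ.+ (q ℕ.+ q)))
      index₁ = ℕ.solve-∀
      index₂ : ∀ j q → q ℕ.+ (j ℕ.+ (q ℕ.+ q)) ≡ j ℕ.+ q ℕ.* 3
      index₂ = ℕ.solve-∀

  aperiodic : f 0 ≡ + 1 → (∀ n → In123 (f n)) → ∀ π → π ≥ 1 → ¬ IsPeriod f π
  aperiodic f0≡1 digit = <-rec _ descend
    where
    descend : ∀ π → (∀ {q} → q < π → q ≥ 1 → ¬ IsPeriod f q) → π ≥ 1 → ¬ IsPeriod f π
    descend π shorter π≥1 per with 3∣period f0≡1 per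
    ... | ℕ.divides zero    refl = contradiction π≥1 λ ()
    ... | ℕ.divides (suc q) refl =
      shorter (ℕ.m<m*n (suc q) 3 (s≤s (s≤s z≤n))) (s≤s z≤n) (period/3 digit (suc q) per)

corollary23 : (f : PowerSeries) → f 0 ≡ + 1 → (∀ n → In123 (f (suc n))) →
                  IsCubeInR f → ¬ Periodic f
corollary23 f f0≡1 digit⁺ (g , _ , f≈g·g·g) (π , π≥1 , per) =
  aperiodic (λ n → trans (f≈g·g·g n) (cube-·ₚ g n)) f0≡1 digit π π≥1 per
  where
  digit : ∀ n → In123 (f n)
  digit zero    = inj₁ f0≡1
  digit (suc n) = digit⁺ n
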